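{- Let $k\ge2$ and let $d>1$ be a squarefree integer. Then $$\sum_{\mathbf{h}\in(\mathbb{Z}/d\mathbb{Z})^{k-1}}e_k(\mathbf{h},d)=0.$$
   Context: For each prime $p$ a nonempty subset $\Omega_p\subset\mathbb{Z}/p\mathbb{Z}$ is given; $r_p=|\Omega_p|/p$. For $\mathbf{h}=(h_1,\dots,h_{k-1})\in\mathbb{Z}^{k-1}$ with $h_0=0$, $N_k(\mathbf{h},p)=\#\{t\bmod p:\ t+h_i\in\Omega_p \text{ for } 0\le i\le k-1\}$, and $\varepsilon_k(\mathbf{h},p)$ is defined by $N_k(\mathbf{h},p)=r_p^{k-1}|\Omega_p|(1+\varepsilon_k(\mathbf{h},p))$. For squarefree $d>1$, $e_k(\mathbf{h},d)=\prod_{p\mid d}\varepsilon_k(\mathbf{h},p)$; it depends only on $\mathbf{h}$ modulo $d$. -}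

module Defs where

open import Data.Bool using (Bool; true; false; _∧_; if_then_else_)
open import Data.Nat as ℕ using (ℕ; zero; suc; _∸_; _^_)
open import Data.Nat.Properties using (m^n≢0)
open import Data.Nat.Divisibility using (_∣_; _∣?_)
open import Data.Nat.Primality using (Prime; prime?)
open import Data.Nat.DivMod using (_mod_)
open import Data.Fin using (Fin; toℕ)
open import Data.Vec using (Vec; []; _∷_; toList)
open import Data.List using (List; []; _∷_; map; foldr; filter; allFin; concatMap; upTo)
open import Data.Integer using (+_)
open import Data.Rational using (ℚ; 0ℚ; 1ℚ; _/_; _-_; _+_; _*_)
open import Relation.Nullary.Decidable using (_×-dec_)
open import Relation.Nullary using (¬_)

allB : {A : Set} → (A → Bool) → List A → Bool
allB p [] = true
allB p (x ∷ xs) = p x ∧ allB p xs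

count : ∀ {n} → (Fin n → Bool) → ℕ
count {n} f = foldr ℕ._+_ 0 (map (λ i → if f i then 1 else 0) (allFin n))

shift : (p : ℕ) → Fin p → ℕ → Fin p
shift (suc q) t h = (toℕ t ℕ.+ h) mod suc q

-- A family: for each p, Ω p ⊆ ℤ/pℤ (as an indicator on Fin p)
Family : Set
Family = (p : ℕ) → Fin p → Bool

-- N_k(h,p) with h = (h_1,…,h_{k-1}) given by representatives hs, h_0 = 0
Nk : Family → (p : ℕ) → List ℕ → ℕ
Nk Ω p hs = count (λ t → Ω p t ∧ allB (λ h → Ω p (shift p t h)) hs)

-- ε_k(h,p) := N_k(h,p) / (r_p^{k-1} |Ω_p|) - 1 = N_k p^{k-1} / |Ω_p|^k - 1
-- (junk value 0 when Ω_p is empty, excluded by hypothesis)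
εk : Family → (k p : ℕ) → List ℕ → ℚ
εk Ω k p hs with count (Ω p)
... | zero  = 0ℚ
... | suc c = ((+ (Nk Ω p hs ℕ.* p ^ (k ∸ 1))) / (suc c ^ k)) {{m^n≢0 (suc c) k}} - 1ℚ

-- primes dividing d (all lie in [0, d] for d > 0)
primeDivisors : ℕ → List ℕ
primeDivisors d = filter (λ p → prime? p ×-dec p ∣? d) (upTo (suc d))

sumℚ : List ℚ → ℚ
sumℚ = foldr _+_ 0ℚ

prodℚ : List ℚ → ℚ
prodℚ = foldr _*_ 1ℚ

ek : Family → (k d : ℕ) → Vec (Fin d) (k ∸ 1) → ℚ
ek Ω k d h = prodℚ (map (λ p → εk Ω k p (toList (Data.Vec.map toℕ h))) (primeDivisors d))

allVecs : (n d : ℕ) → List (Vec (Fin d) n)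
allVecs zero d = [] ∷ []
allVecs (suc n) d = concatMap (λ i → map (i ∷_) (allVecs n d)) (allFin d)

SquareFree : ℕ → Set
SquareFree d = ∀ p → Prime p → ¬ (p ℕ.* p ∣ d)

module Submission where

-- Write d = m p where p is the first prime divisor of d; as d is squarefree, gcd(p, m) = 1.
-- ε_k(h, p) depends only on h mod p and the product over the other primes only on h mod m.
-- Writing every coordinate of h ∈ [0, m p) as j p + a with a < p and j < m, the inner sum over j
-- does not depend on a, because j ↦ j p + a permutes the residues mod m.  So the sum splits as
-- (Σ_{h mod p} ε_k(h, p)) · S, and the first factor vanishes because Σ_h N_k(h, p) = |Ω_p|^k:
-- every t ∈ Ω_p is counted once for each choice of the k - 1 shifts t + h_i ∈ Ω_p.

open import Algebra.Bundles using (CommutativeSemiring; CommutativeRing)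
open import Data.Bool using (Bool; true; false; _∧_; if_then_else_)
open import Data.Empty using (⊥; ⊥-elim)
open import Data.Fin using (Fin; toℕ)
open import Data.Fin.Properties using (fromℕ<-cong; fromℕ<-toℕ; toℕ<n)
open import Data.Integer as ℤ using (+_)
import Data.Integer.Properties as ℤP
import Data.Integer.Tactic.RingSolver as ℤ-Solver
open import Data.List using (List; []; _∷_; map; foldr; allFin; tabulate; concatMap; _++_; length; zipWith; replicate; upTo)
open import Data.List.Membership.Propositional using (_∈_)
open import Data.List.Membership.Propositional.Properties using (∈-filter⁻; ∈-filter⁺; ∈-upTo⁺)
open import Data.List.Properties using (map-tabulate; map-∘; map-++; map-cong; length-replicate)
open import Data.List.Relation.Binary.Pointwise as Pointwise using (Pointwise; []; _∷_)
open import Data.List.Relation.Unary.All as All using (All; []; _∷_)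
import Data.List.Relation.Unary.AllPairs as AllPairs
open import Data.List.Relation.Unary.Any using (here; there)
open import Data.List.Relation.Unary.Unique.Propositional using (Unique)
open import Data.List.Relation.Unary.Unique.Propositional.Properties using (filter⁺; upTo⁺)
open import Data.Nat as ℕ using (ℕ; zero; suc; _+_; _*_; _^_; _∸_; _≤_; _<_; NonZero)
open import Data.Nat.Coprimality using (Coprime; coprime-Bézout)
open import Data.Nat.DivMod using (_mod_; _%_; [m+kn]%n≡m%n; m<n⇒m%n≡m; m%n<n)
open import Data.Nat.Divisibility using (_∣_; divides; _∣?_; ∣⇒≤; *-monoˡ-∣)
open import Data.Nat.GCD using (module Bézout)
open import Data.Nat.ListAction using (product)
open import Data.Nat.Primality using (Prime; prime?; euclidsLemma; prime⇒irreducible; ¬prime[1])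
open import Data.Nat.Primality.Factorisation using (factorise; PrimeFactorisation)
import Data.Nat.Properties as ℕP
open import Data.Nat.Tactic.RingSolver using (solve-∀)
open import Data.Product using (∃₂; ∃-syntax; _,_; _×_; proj₁; proj₂)
open import Data.Rational as ℚ using (ℚ; _/_; 0ℚ; 1ℚ; _-_; toℚᵘ)
import Data.Rational.Properties as ℚP
import Data.Rational.Unnormalised as ℚᵘ
import Data.Rational.Unnormalised.Properties as ℚᵘP
open import Data.Sum using (inj₁; inj₂)
import Data.Vec as Vec
open import Function using (_∘_; id; case_of_)
open import Relation.Binary.PropositionalEquality using (_≡_; _≢_; refl; cong; cong₂; subst; ≢-sym)
import Relation.Binary.PropositionalEquality as ≡
open import Relation.Nullary.Decidable using (_×-dec_)

open import Algebra.Properties.Group ℚP.+-0-group using (identityˡ-unique; //-rightDividesˡ)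
open import Defs

infix 4 _≡_[mod_]

_≡_[mod_] : ℕ → ℕ → ℕ → Set
x ≡ y [mod m ] = ∃₂ λ a b → x + a * m ≡ y + b * m

≡-mod-refl : ∀ m x → x ≡ x [mod m ]
≡-mod-refl m x = 0 , 0 , refl

Pointwise-≡-mod-refl : ∀ m L → Pointwise _≡_[mod m ] L L
Pointwise-≡-mod-refl m [] = []
Pointwise-≡-mod-refl m (x ∷ L) = ≡-mod-refl m x ∷ Pointwise-≡-mod-refl m L

+-≡-mod : ∀ {m x y} t → x ≡ y [mod m ] → t + x ≡ t + y [mod m ]
+-≡-mod {m} {x} {y} t (a , b , e) =
  a , b , ≡.trans (ℕP.+-assoc t x (a * m)) (≡.trans (cong (_+_ t) e) (≡.sym (ℕP.+-assoc t y (b * m))))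

≡-mod-∣ : ∀ {q m x y} → q ∣ m → x ≡ y [mod m ] → x ≡ y [mod q ]
≡-mod-∣ {q} {_} {x} {y} (divides c refl) (a , b , e) = a * c , b * c ,
  ≡.trans (cong (_+_ x) (ℕP.*-assoc a c q)) (≡.trans e (cong (_+_ y) (≡.sym (ℕP.*-assoc b c q))))

mixedRadix : ℕ → List ℕ → List ℕ → List ℕ
mixedRadix p = zipWith (λ j a → j * p + a)

mixedRadix-≡-mod : ∀ p J A → length J ≡ length A → Pointwise _≡_[mod p ] (mixedRadix p J A) A
mixedRadix-≡-mod p [] [] _ = []
mixedRadix-≡-mod p (j ∷ J) (a ∷ A) e =
  (0 , j , ≡.trans (ℕP.+-identityʳ (j * p + a)) (ℕP.+-comm (j * p) a))
  ∷ mixedRadix-≡-mod p J A (ℕP.suc-injective e)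

module BoxSums {c ℓ} (R : CommutativeSemiring c ℓ) where

  open CommutativeSemiring R renaming (_+_ to _⊕_; _*_ to _⊗_; refl to ≈-refl)
  open import Algebra.Properties.CommutativeSemigroup +-commutativeSemigroup using (interchange)
  open import Relation.Binary.Reasoning.Setoid setoid

  sumBelow : ℕ → (ℕ → Carrier) → Carrier
  sumBelow zero    f = 0#
  sumBelow (suc n) f = f 0 ⊕ sumBelow n (f ∘ suc)

  sumBox : ℕ → ℕ → (List ℕ → Carrier) → Carrier
  sumBox zero    d f = f []
  sumBox (suc n) d f = sumBelow d (λ i → sumBox n d (f ∘ (i ∷_)))

  sumList : List Carrier → Carrier
  sumList = foldr _⊕_ 0#

  Periodic : ℕ → (ℕ → Carrier) → Set _
  Periodic m g = ∀ {x y} → x ≡ y [mod m ] → g x ≈ g y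

  PeriodicBox : ℕ → (List ℕ → Carrier) → Set _
  PeriodicBox m G = ∀ {K L} → Pointwise _≡_[mod m ] K L → G K ≈ G L

  sumBelow-cong : ∀ n {f g : ℕ → Carrier} → (∀ x → f x ≈ g x) → sumBelow n f ≈ sumBelow n g
  sumBelow-cong zero    f≈g = ≈-refl
  sumBelow-cong (suc n) f≈g = +-cong (f≈g 0) (sumBelow-cong n (f≈g ∘ suc))

  sumBelow-0# : ∀ n → sumBelow n (λ _ → 0#) ≈ 0#
  sumBelow-0# zero    = ≈-refl
  sumBelow-0# (suc n) = trans (+-congˡ (sumBelow-0# n)) (+-identityˡ 0#)

  sumBelow-⊕ : ∀ n f g → sumBelow n (λ x → f x ⊕ g x) ≈ sumBelow n f ⊕ sumBelow n g
  sumBelow-⊕ zero    f g = sym (+-identityˡ 0#)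
  sumBelow-⊕ (suc n) f g = trans (+-congˡ (sumBelow-⊕ n (f ∘ suc) (g ∘ suc))) (interchange _ _ _ _)

  sumBelow-⊗ʳ : ∀ n f c → sumBelow n (λ x → f x ⊗ c) ≈ sumBelow n f ⊗ c
  sumBelow-⊗ʳ zero    f c = sym (zeroˡ c)
  sumBelow-⊗ʳ (suc n) f c = trans (+-congˡ (sumBelow-⊗ʳ n (f ∘ suc) c)) (sym (distribʳ c _ _))

  sumBelow-+ : ∀ m n f → sumBelow (m + n) f ≈ sumBelow m f ⊕ sumBelow n (λ x → f (m + x))
  sumBelow-+ zero    n f = sym (+-identityˡ _)
  sumBelow-+ (suc m) n f = trans (+-congˡ (sumBelow-+ m n (f ∘ suc))) (sym (+-assoc _ _ _))

  sumBelow-comm : ∀ m n (f : ℕ → ℕ → Carrier) →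
    sumBelow m (λ i → sumBelow n (f i)) ≈ sumBelow n (λ j → sumBelow m (λ i → f i j))
  sumBelow-comm zero    n f = sym (sumBelow-0# n)
  sumBelow-comm (suc m) n f = trans (+-congˡ (sumBelow-comm m n (f ∘ suc))) (sym (sumBelow-⊕ n _ _))

  sumBelow-blocks : ∀ m p f → sumBelow (m * p) f ≈ sumBelow p (λ a → sumBelow m (λ j → f (j * p + a)))
  sumBelow-blocks zero    p f = sym (sumBelow-0# p)
  sumBelow-blocks (suc m) p f = begin
    sumBelow (p + m * p) f
      ≈⟨ sumBelow-+ p (m * p) f ⟩
    sumBelow p f ⊕ sumBelow (m * p) (λ x → f (p + x))
      ≈⟨ +-congˡ (sumBelow-blocks m p _) ⟩
    sumBelow p f ⊕ sumBelow p (λ a → sumBelow m (λ j → f (p + (j * p + a))))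
      ≈⟨ sym (sumBelow-⊕ p _ _) ⟩
    sumBelow p (λ a → f a ⊕ sumBelow m (λ j → f (p + (j * p + a))))
      ≈⟨ sumBelow-cong p (λ a → +-congˡ (sumBelow-cong m (λ j →
           reflexive (cong f (≡.sym (ℕP.+-assoc p (j * p) a)))))) ⟩
    sumBelow p (λ a → sumBelow (suc m) (λ j → f (j * p + a))) ∎

  sumBelow-last : ∀ n f → sumBelow (suc n) f ≈ sumBelow n f ⊕ f n
  sumBelow-last zero    f = +-comm (f 0) 0#
  sumBelow-last (suc n) f = trans (+-congˡ (sumBelow-last n (f ∘ suc))) (sym (+-assoc _ _ _))

  sumBelow-rotate : ∀ n f → f n ≈ f 0 → sumBelow n (f ∘ suc) ≈ sumBelow n f
  sumBelow-rotate zero    f _     = ≈-refl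
  sumBelow-rotate (suc n) f fn≈f0 = begin
    sumBelow (suc n) (f ∘ suc)      ≈⟨ sumBelow-last n (f ∘ suc) ⟩
    sumBelow n (f ∘ suc) ⊕ f (suc n) ≈⟨ +-congˡ fn≈f0 ⟩
    sumBelow n (f ∘ suc) ⊕ f 0       ≈⟨ +-comm _ _ ⟩
    sumBelow (suc n) f               ∎

  invariant-+-multiple : ∀ {f : ℕ → Carrier} k → (∀ a → f (a + k) ≈ f a) → ∀ x a → f (a + x * k) ≈ f a
  invariant-+-multiple {f} k inv zero    a = reflexive (cong f (ℕP.+-identityʳ a))
  invariant-+-multiple {f} k inv (suc x) a = begin
    f (a + (k + x * k))  ≈⟨ reflexive (cong f (≡.sym (ℕP.+-assoc a k (x * k)))) ⟩
    f (a + k + x * k)    ≈⟨ invariant-+-multiple k inv x (a + k) ⟩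
    f (a + k)            ≈⟨ inv a ⟩
    f a                  ∎

  -- By 1 + y m = x p (or 1 + x p = y m), a step of +1 is a multiple of p followed by undoing a multiple of m.
  invariant-+-coprime : ∀ {f : ℕ → Carrier} {p m} → Bézout.Identity 1 p m →
    (∀ a → f (a + p) ≈ f a) → (∀ a → f (a + m) ≈ f a) → ∀ a → f a ≈ f 0
  invariant-+-coprime {f} {p} {m} bézout inv-p inv-m = constant
    where
    invariant-suc : ∀ a → Bézout.Identity 1 p m → f (suc a) ≈ f a
    invariant-suc a (Bézout.+- x y 1+ym≡xp) = begin
      f (suc a)             ≈⟨ invariant-+-multiple m inv-m y (suc a) ⟨
      f (suc a + y * m)     ≈⟨ reflexive (cong f (≡.trans (≡.sym (ℕP.+-suc a _)) (cong (_+_ a) 1+ym≡xp))) ⟩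
      f (a + x * p)         ≈⟨ invariant-+-multiple p inv-p x a ⟩
      f a                   ∎
    invariant-suc a (Bézout.-+ x y 1+xp≡ym) = begin
      f (suc a)             ≈⟨ invariant-+-multiple p inv-p x (suc a) ⟨
      f (suc a + x * p)     ≈⟨ reflexive (cong f (≡.trans (≡.sym (ℕP.+-suc a _)) (cong (_+_ a) 1+xp≡ym))) ⟩
      f (a + y * m)         ≈⟨ invariant-+-multiple m inv-m y a ⟩
      f a                   ∎

    constant : ∀ a → f a ≈ f 0
    constant zero    = ≈-refl
    constant (suc a) = trans (invariant-suc a bézout) (constant a)

  sumBelow-progression : ∀ {m p} → Bézout.Identity 1 p m → ∀ {g} → Periodic m g →
    ∀ a b → sumBelow m (λ j → g (j * p + a)) ≈ sumBelow m (λ j → g (j * p + b))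
  sumBelow-progression {m} {p} bézout {g} periodic a b =
    trans (invariant-+-coprime bézout shift-p shift-m a) (sym (invariant-+-coprime bézout shift-p shift-m b))
    where
    S : ℕ → Carrier
    S a = sumBelow m (λ j → g (j * p + a))

    shift-m : ∀ a → S (a + m) ≈ S a
    shift-m a = sumBelow-cong m (λ j → periodic (0 , 1 , add-m j a m p))
      where
      add-m : ∀ j a m p → j * p + (a + m) + 0 * m ≡ j * p + a + 1 * m
      add-m = solve-∀

    shift-p : ∀ a → S (a + p) ≈ S a
    shift-p a = begin
      S (a + p)
        ≈⟨ sumBelow-cong m (λ j → reflexive (cong g (reindex j p a))) ⟩
      sumBelow m (λ j → g (suc j * p + a))
        ≈⟨ sumBelow-rotate m (λ j → g (j * p + a)) (periodic (0 , p , wrap m p a)) ⟩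
      S a ∎
      where
      reindex : ∀ j p a → j * p + (a + p) ≡ p + j * p + a
      reindex = solve-∀
      wrap : ∀ m p a → m * p + a + 0 * m ≡ a + p * m
      wrap = solve-∀

  sumBelow-translate : ∀ {m g} → Periodic m g → ∀ a → sumBelow m (λ j → g (a + j)) ≈ sumBelow m g
  sumBelow-translate {m} {g} periodic a = begin
    sumBelow m (λ j → g (a + j))       ≈⟨ sumBelow-cong m (λ j → reflexive (cong g (reindex a j))) ⟩
    sumBelow m (λ j → g (j * 1 + a))   ≈⟨ sumBelow-progression (Bézout.+- 1 0 refl) periodic a 0 ⟩
    sumBelow m (λ j → g (j * 1 + 0))   ≈⟨ sumBelow-cong m (λ j → reflexive (cong g (reindex 0 j))) ⟨
    sumBelow m g                       ∎
    where
    reindex : ∀ a j → a + j ≡ j * 1 + a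
    reindex = solve-∀

  sumBox-cong : ∀ n d {f g : List ℕ → Carrier} → (∀ L → length L ≡ n → f L ≈ g L) →
    sumBox n d f ≈ sumBox n d g
  sumBox-cong zero    d f≈g = f≈g [] refl
  sumBox-cong (suc n) d f≈g = sumBelow-cong d (λ i → sumBox-cong n d (λ L e → f≈g (i ∷ L) (cong suc e)))

  sumBox-0# : ∀ n d → sumBox n d (λ _ → 0#) ≈ 0#
  sumBox-0# zero    d = ≈-refl
  sumBox-0# (suc n) d = trans (sumBelow-cong d (λ _ → sumBox-0# n d)) (sumBelow-0# d)

  sumBox-⊕ : ∀ n d f g → sumBox n d (λ L → f L ⊕ g L) ≈ sumBox n d f ⊕ sumBox n d g
  sumBox-⊕ zero    d f g = ≈-refl
  sumBox-⊕ (suc n) d f g = trans (sumBelow-cong d (λ i → sumBox-⊕ n d _ _)) (sumBelow-⊕ d _ _)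

  sumBox-⊗ʳ : ∀ n d f c → sumBox n d (λ L → f L ⊗ c) ≈ sumBox n d f ⊗ c
  sumBox-⊗ʳ zero    d f c = ≈-refl
  sumBox-⊗ʳ (suc n) d f c = trans (sumBelow-cong d (λ i → sumBox-⊗ʳ n d _ c)) (sumBelow-⊗ʳ d _ c)

  sumBox-⊗ˡ : ∀ n d f c → sumBox n d (λ L → c ⊗ f L) ≈ c ⊗ sumBox n d f
  sumBox-⊗ˡ zero    d f c = ≈-refl
  sumBox-⊗ˡ (suc n) d f c = begin
    sumBelow d (λ i → sumBox n d (λ L → c ⊗ f (i ∷ L)))   ≈⟨ sumBelow-cong d (λ i → sumBox-⊗ˡ n d _ c) ⟩
    sumBelow d (λ i → c ⊗ sumBox n d (f ∘ (i ∷_)))        ≈⟨ sumBelow-cong d (λ i → *-comm c _) ⟩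
    sumBelow d (λ i → sumBox n d (f ∘ (i ∷_)) ⊗ c)        ≈⟨ sumBelow-⊗ʳ d _ c ⟩
    sumBox (suc n) d f ⊗ c                                ≈⟨ *-comm _ c ⟩
    c ⊗ sumBox (suc n) d f                                ∎

  sumBox-sumBelow : ∀ n d r (g : ℕ → List ℕ → Carrier) →
    sumBox n d (λ L → sumBelow r (λ x → g x L)) ≈ sumBelow r (λ x → sumBox n d (g x))
  sumBox-sumBelow zero    d r g = ≈-refl
  sumBox-sumBelow (suc n) d r g = trans (sumBelow-cong d (λ i → sumBox-sumBelow n d r _)) (sumBelow-comm d r _)

  sumBox-sumList : ∀ {A : Set} n d (xs : List A) (g : A → List ℕ → Carrier) →
    sumBox n d (λ L → sumList (map (λ x → g x L) xs)) ≈ sumList (map (λ x → sumBox n d (g x)) xs)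
  sumBox-sumList n d []       g = sumBox-0# n d
  sumBox-sumList n d (x ∷ xs) g = trans (sumBox-⊕ n d _ _) (+-congˡ (sumBox-sumList n d xs g))

  sumBox-blocks : ∀ n m p f →
    sumBox n (m * p) f ≈ sumBox n p (λ A → sumBox n m (λ J → f (mixedRadix p J A)))
  sumBox-blocks zero    m p f = ≈-refl
  sumBox-blocks (suc n) m p f = begin
    sumBelow (m * p) (λ i → sumBox n (m * p) (f ∘ (i ∷_)))
      ≈⟨ sumBelow-blocks m p _ ⟩
    sumBelow p (λ a → sumBelow m (λ j → sumBox n (m * p) (f ∘ ((j * p + a) ∷_))))
      ≈⟨ sumBelow-cong p (λ a → sumBelow-cong m (λ j → sumBox-blocks n m p _)) ⟩
    sumBelow p (λ a → sumBelow m (λ j → sumBox n p (λ A → sumBox n m (λ J → f ((j * p + a) ∷ mixedRadix p J A)))))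
      ≈⟨ sumBelow-cong p (λ a → sumBox-sumBelow n p m _) ⟨
    sumBox (suc n) p (λ A → sumBox (suc n) m (λ J → f (mixedRadix p J A))) ∎

  sumBox-mixedRadix-offset : ∀ {m p} → Bézout.Identity 1 p m → ∀ {G} → PeriodicBox m G →
    ∀ n {A B} → length A ≡ n → length B ≡ n →
    sumBox n m (λ J → G (mixedRadix p J A)) ≈ sumBox n m (λ J → G (mixedRadix p J B))
  sumBox-mixedRadix-offset bézout periodic zero {[]} {[]} _ _ = ≈-refl
  sumBox-mixedRadix-offset {m} {p} bézout {G} periodic (suc n) {a ∷ A} {b ∷ B} |A| |B| = begin
    sumBelow m (λ j → sumBox n m (λ J → G ((j * p + a) ∷ mixedRadix p J A)))
      ≈⟨ sumBelow-cong m (λ j → sumBox-mixedRadix-offset bézout (λ K≡L → periodic (≡-mod-refl m _ ∷ K≡L)) n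
           (ℕP.suc-injective |A|) (ℕP.suc-injective |B|)) ⟩
    sumBelow m (λ j → sumBox n m (λ J → G ((j * p + a) ∷ mixedRadix p J B)))
      ≈⟨ sumBox-sumBelow n m m _ ⟨
    sumBox n m (λ J → sumBelow m (λ j → G ((j * p + a) ∷ mixedRadix p J B)))
      ≈⟨ sumBox-cong n m (λ J _ → sumBelow-progression bézout
           (λ x≡y → periodic (x≡y ∷ Pointwise-≡-mod-refl m (mixedRadix p J B))) a b) ⟩
    sumBox n m (λ J → sumBelow m (λ j → G ((j * p + b) ∷ mixedRadix p J B)))
      ≈⟨ sumBox-sumBelow n m m _ ⟩
    sumBelow m (λ j → sumBox n m (λ J → G ((j * p + b) ∷ mixedRadix p J B))) ∎

  sumBox-periodic-product : ∀ {m p} → Bézout.Identity 1 p m → ∀ {ε G} → PeriodicBox p ε → PeriodicBox m G →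
    ∀ n → sumBox n p ε ≈ 0# → sumBox n (m * p) (λ L → ε L ⊗ G L) ≈ 0#
  sumBox-periodic-product {m} {p} bézout {ε} {G} periodic-ε periodic-G n Σε≈0 = begin
    sumBox n (m * p) (λ L → ε L ⊗ G L)
      ≈⟨ sumBox-blocks n m p _ ⟩
    sumBox n p (λ A → sumBox n m (λ J → ε (mixedRadix p J A) ⊗ G (mixedRadix p J A)))
      ≈⟨ sumBox-cong n p (λ A |A| → sumBox-cong n m (λ J |J| →
           *-congʳ (periodic-ε (mixedRadix-≡-mod p J A (≡.trans |J| (≡.sym |A|)))))) ⟩
    sumBox n p (λ A → sumBox n m (λ J → ε A ⊗ G (mixedRadix p J A)))
      ≈⟨ sumBox-cong n p (λ A |A| → trans (sumBox-⊗ˡ n m _ (ε A))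
           (*-congˡ (sumBox-mixedRadix-offset bézout periodic-G n |A| (length-replicate n)))) ⟩
    sumBox n p (λ A → ε A ⊗ S₀)
      ≈⟨ sumBox-⊗ʳ n p ε S₀ ⟩
    sumBox n p ε ⊗ S₀
      ≈⟨ *-congʳ Σε≈0 ⟩
    0# ⊗ S₀
      ≈⟨ zeroˡ S₀ ⟩
    0# ∎
    where
    S₀ : Carrier
    S₀ = sumBox n m (λ J → G (mixedRadix p J (replicate n 0)))

  sumList-map-cong : ∀ {A : Set} xs {f g : A → Carrier} → (∀ x → f x ≈ g x) →
    sumList (map f xs) ≈ sumList (map g xs)
  sumList-map-cong []       f≈g = ≈-refl
  sumList-map-cong (x ∷ xs) f≈g = +-cong (f≈g x) (sumList-map-cong xs f≈g)

  sumList-⊗ʳ : ∀ {A : Set} xs (f : A → Carrier) c →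
    sumList (map (λ x → f x ⊗ c) xs) ≈ sumList (map f xs) ⊗ c
  sumList-⊗ʳ []       f c = sym (zeroˡ c)
  sumList-⊗ʳ (x ∷ xs) f c = trans (+-congˡ (sumList-⊗ʳ xs f c)) (sym (distribʳ c _ _))

  sumList-++ : ∀ xs ys → sumList (xs ++ ys) ≈ sumList xs ⊕ sumList ys
  sumList-++ []       ys = sym (+-identityˡ _)
  sumList-++ (x ∷ xs) ys = trans (+-congˡ (sumList-++ xs ys)) (sym (+-assoc _ _ _))

  sumList-concatMap : ∀ {A B : Set} (f : B → Carrier) (g : A → List B) xs →
    sumList (map f (concatMap g xs)) ≈ sumList (map (λ x → sumList (map f (g x))) xs)
  sumList-concatMap f g []       = ≈-refl
  sumList-concatMap f g (x ∷ xs) = begin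
    sumList (map f (g x ++ concatMap g xs))            ≡⟨ cong sumList (map-++ f (g x) (concatMap g xs)) ⟩
    sumList (map f (g x) ++ map f (concatMap g xs))    ≈⟨ sumList-++ (map f (g x)) _ ⟩
    sumList (map f (g x)) ⊕ sumList (map f (concatMap g xs)) ≈⟨ +-congˡ (sumList-concatMap f g xs) ⟩
    sumList (map (λ x → sumList (map f (g x))) (x ∷ xs)) ∎

  sumList-allFin : ∀ d (g : ℕ → Carrier) → sumList (map (g ∘ toℕ) (allFin d)) ≈ sumBelow d g
  sumList-allFin d g = trans (reflexive (cong sumList (map-tabulate {n = d} id (g ∘ toℕ)))) (sumList-tabulate d g)
    where
    sumList-tabulate : ∀ d g → sumList (tabulate {n = d} (g ∘ toℕ)) ≈ sumBelow d g
    sumList-tabulate zero    g = ≈-refl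
    sumList-tabulate (suc d) g = +-congˡ (sumList-tabulate d (g ∘ suc))

  sumList-allVecs : ∀ n d (f : List ℕ → Carrier) →
    sumList (map (λ h → f (Vec.toList (Vec.map toℕ h))) (allVecs n d)) ≈ sumBox n d f
  sumList-allVecs zero    d f = +-identityʳ (f [])
  sumList-allVecs (suc n) d f = begin
    sumList (map F (concatMap (λ i → map (i Vec.∷_) (allVecs n d)) (allFin d)))
      ≈⟨ sumList-concatMap F _ (allFin d) ⟩
    sumList (map (λ i → sumList (map F (map (i Vec.∷_) (allVecs n d)))) (allFin d))
      ≡⟨ cong sumList (map-cong (λ i → cong sumList (≡.sym (map-∘ (allVecs n d)))) (allFin d)) ⟩
    sumList (map (λ i → sumList (map (λ h → f (toℕ i ∷ Vec.toList (Vec.map toℕ h))) (allVecs n d))) (allFin d))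
      ≈⟨ sumList-map-cong (allFin d) (λ i → sumList-allVecs n d (f ∘ (toℕ i ∷_))) ⟩
    sumList (map (λ i → sumBox n d (f ∘ (toℕ i ∷_))) (allFin d))
      ≈⟨ sumList-allFin d (λ i → sumBox n d (f ∘ (i ∷_))) ⟩
    sumBox (suc n) d f ∎
    where
    F : Vec.Vec (Fin d) (suc n) → Carrier
    F h = f (Vec.toList (Vec.map toℕ h))

module ℕΣ = BoxSums ℕP.+-*-commutativeSemiring
open ℕΣ using (sumBelow; sumBox)

indicator : Bool → ℕ
indicator b = if b then 1 else 0

indicator-∧ : ∀ a b → indicator (a ∧ b) ≡ indicator a * indicator b
indicator-∧ true  b = ≡.sym (ℕP.+-identityʳ (indicator b))
indicator-∧ false b = refl

indicator-allB : ∀ (f : ℕ → Bool) L → indicator (allB f L) ≡ product (map (indicator ∘ f) L)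
indicator-allB f []      = refl
indicator-allB f (x ∷ L) = ≡.trans (indicator-∧ (f x) (allB f L)) (cong (indicator (f x) *_) (indicator-allB f L))

sumBelow-const : ∀ d k → sumBelow d (λ _ → k) ≡ d * k
sumBelow-const zero    k = refl
sumBelow-const (suc d) k = cong (_+_ k) (sumBelow-const d k)

sumBox-1 : ∀ n d → sumBox n d (λ _ → 1) ≡ d ^ n
sumBox-1 zero    d = refl
sumBox-1 (suc n) d = ≡.trans (ℕΣ.sumBelow-cong d (λ _ → sumBox-1 n d)) (sumBelow-const d (d ^ n))

sumBox-product : ∀ n d g → sumBox n d (λ L → product (map g L)) ≡ sumBelow d g ^ n
sumBox-product zero    d g = refl
sumBox-product (suc n) d g = begin
  sumBelow d (λ i → sumBox n d (λ L → g i * product (map g L)))  ≡⟨ ℕΣ.sumBelow-cong d (λ i → ℕΣ.sumBox-⊗ˡ n d _ (g i)) ⟩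
  sumBelow d (λ i → g i * sumBox n d (λ L → product (map g L)))  ≡⟨ ℕΣ.sumBelow-⊗ʳ d g _ ⟩
  sumBelow d g * sumBox n d (λ L → product (map g L))            ≡⟨ cong (sumBelow d g *_) (sumBox-product n d g) ⟩
  sumBelow d g ^ suc n                                          ∎
  where open ≡.≡-Reasoning

mod-cong : ∀ {q x y} → x ≡ y [mod suc q ] → x mod suc q ≡ y mod suc q
mod-cong {q} {x} {y} (a , b , e) = fromℕ<-cong _ _ x%≡y% (m%n<n x (suc q)) (m%n<n y (suc q))
  where
  x%≡y% : x % suc q ≡ y % suc q
  x%≡y% = ≡.trans (≡.sym ([m+kn]%n≡m%n x a (suc q))) (≡.trans (cong (_% suc q) e) ([m+kn]%n≡m%n y b (suc q)))

toℕ-mod : ∀ {q} (i : Fin (suc q)) → toℕ i mod suc q ≡ i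
toℕ-mod {q} i =
  ≡.trans (fromℕ<-cong _ _ (m<n⇒m%n≡m (toℕ<n i)) (m%n<n (toℕ i) (suc q)) (toℕ<n i)) (fromℕ<-toℕ i (toℕ<n i))

count-sumBelow : ∀ {q} (f : Fin (suc q) → Bool) → count f ≡ sumBelow (suc q) (λ x → indicator (f (x mod suc q)))
count-sumBelow {q} f = ≡.trans
  (cong ℕΣ.sumList (map-cong (λ i → cong (indicator ∘ f) (≡.sym (toℕ-mod i))) (allFin (suc q))))
  (ℕΣ.sumList-allFin (suc q) (λ x → indicator (f (x mod suc q))))

sumBelow-window : ∀ (Ω : Family) q (t : Fin (suc q)) →
  sumBelow (suc q) (λ h → indicator (Ω (suc q) (shift (suc q) t h))) ≡ count (Ω (suc q))
sumBelow-window Ω q t = ≡.trans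
  (ℕΣ.sumBelow-translate (λ x≡y → cong (indicator ∘ Ω (suc q)) (mod-cong x≡y)) (toℕ t))
  (≡.sym (count-sumBelow (Ω (suc q))))

sumBox-Nk : ∀ (Ω : Family) q n → sumBox n (suc q) (Nk Ω (suc q)) ≡ count (Ω (suc q)) ^ suc n
sumBox-Nk Ω q n = begin
  sumBox n p (Nk Ω p)
    ≡⟨ ℕΣ.sumBox-sumList n p (allFin p) (λ t L → indicator (Ω p t ∧ allB (window t) L)) ⟩
  ℕΣ.sumList (map (λ t → sumBox n p (λ L → indicator (Ω p t ∧ allB (window t) L))) (allFin p))
    ≡⟨ ℕΣ.sumList-map-cong (allFin p) term ⟩
  ℕΣ.sumList (map (λ t → indicator (Ω p t) * count (Ω p) ^ n) (allFin p))
    ≡⟨ ℕΣ.sumList-⊗ʳ (allFin p) (indicator ∘ Ω p) _ ⟩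
  count (Ω p) ^ suc n ∎
  where
  open ≡.≡-Reasoning

  p : ℕ
  p = suc q

  window : Fin p → ℕ → Bool
  window t h = Ω p (shift p t h)

  term : ∀ t → sumBox n p (λ L → indicator (Ω p t ∧ allB (window t) L)) ≡ indicator (Ω p t) * count (Ω p) ^ n
  term t = begin
    sumBox n p (λ L → indicator (Ω p t ∧ allB (window t) L))
      ≡⟨ ℕΣ.sumBox-cong n p (λ L _ →
           ≡.trans (indicator-∧ (Ω p t) _) (cong (indicator (Ω p t) *_) (indicator-allB (window t) L))) ⟩
    sumBox n p (λ L → indicator (Ω p t) * product (map (indicator ∘ window t) L))
      ≡⟨ ℕΣ.sumBox-⊗ˡ n p _ (indicator (Ω p t)) ⟩
    indicator (Ω p t) * sumBox n p (λ L → product (map (indicator ∘ window t) L))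
      ≡⟨ cong (indicator (Ω p t) *_) (sumBox-product n p _) ⟩
    indicator (Ω p t) * sumBelow p (indicator ∘ window t) ^ n
      ≡⟨ cong (λ s → indicator (Ω p t) * s ^ n) (sumBelow-window Ω q t) ⟩
    indicator (Ω p t) * count (Ω p) ^ n ∎

count-cong : ∀ {n} {f g : Fin n → Bool} → (∀ t → f t ≡ g t) → count f ≡ count g
count-cong {n} f≗g = cong ℕΣ.sumList (map-cong (cong indicator ∘ f≗g) (allFin n))

Nk-periodic : ∀ (Ω : Family) p → ℕΣ.PeriodicBox p (Nk Ω p)
Nk-periodic Ω zero    _   = refl
Nk-periodic Ω (suc q) K≡L = count-cong (λ t → cong (Ω (suc q) t ∧_) (allB-window t K≡L))
  where
  allB-window : ∀ t {K L} → Pointwise _≡_[mod suc q ] K L →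
    allB (λ h → Ω (suc q) (shift (suc q) t h)) K ≡ allB (λ h → Ω (suc q) (shift (suc q) t h)) L
  allB-window t []             = refl
  allB-window t (h≡h′ ∷ K≡L) =
    cong₂ _∧_ (cong (Ω (suc q)) (mod-cong (+-≡-mod (toℕ t) h≡h′))) (allB-window t K≡L)

/-≡ : ∀ x c y e .{{_ : NonZero c}} .{{_ : NonZero e}} → x * e ≡ y * c → + x / c ≡ + y / e
/-≡ x c@(suc _) y e@(suc _) xe≡yc = ℚP.fromℚᵘ-cong {+ x ℚᵘ./ c} {+ y ℚᵘ./ e} (ℚᵘ.*≡* (begin
  + x ℤ.* + e  ≡⟨ ℤP.pos-* x e ⟨
  + (x * e)    ≡⟨ cong +_ xe≡yc ⟩
  + (y * c)    ≡⟨ ℤP.pos-* y c ⟩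
  + y ℤ.* + c  ∎))
  where open ≡.≡-Reasoning

/-distribʳ-+ : ∀ x y c .{{_ : NonZero c}} → + (x + y) / c ≡ + x / c ℚ.+ + y / c
/-distribʳ-+ x y c@(suc _) = ℚP.toℚᵘ-injective (begin
    toℚᵘ (+ (x + y) / c)                ≈⟨ ℚP.toℚᵘ-fromℚᵘ (+ (x + y) ℚᵘ./ c) ⟩
    + (x + y) ℚᵘ./ c                    ≈⟨ ℚᵘ.*≡* cross ⟩
    + x ℚᵘ./ c ℚᵘ.+ + y ℚᵘ./ c          ≈⟨ ℚᵘP.+-cong (ℚP.toℚᵘ-fromℚᵘ (+ x ℚᵘ./ c)) (ℚP.toℚᵘ-fromℚᵘ (+ y ℚᵘ./ c)) ⟨
    toℚᵘ (+ x / c) ℚᵘ.+ toℚᵘ (+ y / c)  ≈⟨ ℚP.toℚᵘ-homo-+ (+ x / c) (+ y / c) ⟨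
    toℚᵘ (+ x / c ℚ.+ + y / c)          ∎)
  where
  open ℚᵘP.≃-Reasoning
  cross : + (x + y) ℤ.* + (c * c) ≡ (+ x ℤ.* + c ℤ.+ + y ℤ.* + c) ℤ.* + c
  cross = ≡.trans (cong₂ ℤ._*_ (ℤP.pos-+ x y) (ℤP.pos-* c c)) (distrib (+ x) (+ y) (+ c))
    where
    distrib : ∀ x y c → (x ℤ.+ y) ℤ.* (c ℤ.* c) ≡ (x ℤ.* c ℤ.+ y ℤ.* c) ℤ.* c
    distrib = ℤ-Solver.solve-∀

module ℚΣ = BoxSums (CommutativeRing.commutativeSemiring ℚP.+-*-commutativeRing)

sumBox-/ : ∀ n d f c .{{_ : NonZero c}} → ℚΣ.sumBox n d (λ L → + f L / c) ≡ + sumBox n d f / c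
sumBox-/ zero    d f c = refl
sumBox-/ (suc n) d f c = ≡.trans (ℚΣ.sumBelow-cong d (λ i → sumBox-/ n d (f ∘ (i ∷_)) c)) (sumBelow-/ d _)
  where
  sumBelow-/ : ∀ d g → ℚΣ.sumBelow d (λ x → + g x / c) ≡ + sumBelow d g / c
  sumBelow-/ zero    g = /-≡ 0 1 0 c refl
  sumBelow-/ (suc d) g = ≡.trans (cong (+ g 0 / c ℚ.+_) (sumBelow-/ d (g ∘ suc))) (≡.sym (/-distribʳ-+ (g 0) _ c))

εk-cong : ∀ (Ω : Family) k p {K L} → Nk Ω p K ≡ Nk Ω p L → εk Ω k p K ≡ εk Ω k p L
εk-cong Ω k p e with count (Ω p)
... | zero  = refl
... | suc c = cong (λ N → (+ (N * p ^ (k ∸ 1)) / suc c ^ k) {{ℕP.m^n≢0 (suc c) k}} - 1ℚ) e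

εk-periodic : ∀ (Ω : Family) k p → ℚΣ.PeriodicBox p (εk Ω k p)
εk-periodic Ω k p = εk-cong Ω k p ∘ Nk-periodic Ω p

εk-empty : ∀ (Ω : Family) k p L → count (Ω p) ≡ 0 → εk Ω k p L ≡ 0ℚ
εk-empty Ω k p L e with count (Ω p)
εk-empty Ω k p L refl | .0 = refl

εk-nonempty : ∀ (Ω : Family) k p L c → count (Ω p) ≡ suc c →
  εk Ω k p L ≡ (+ (Nk Ω p L * p ^ (k ∸ 1)) / suc c ^ k) {{ℕP.m^n≢0 (suc c) k}} - 1ℚ
εk-nonempty Ω k p L c e with count (Ω p)
εk-nonempty Ω k p L c refl | .(suc c) = refl

sumBox-εk : ∀ (Ω : Family) n p → ℚΣ.sumBox n p (εk Ω (suc n) p) ≡ 0ℚ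
sumBox-εk Ω n p = by-count p (count (Ω p)) refl
  where
  by-count : ∀ p c → count (Ω p) ≡ c → ℚΣ.sumBox n p (εk Ω (suc n) p) ≡ 0ℚ
  by-count p         zero    |Ω|≡0 =
    ≡.trans (ℚΣ.sumBox-cong n p (λ L _ → εk-empty Ω (suc n) p L |Ω|≡0)) (ℚΣ.sumBox-0# n p)
  by-count zero      (suc c) ()
  by-count p@(suc q) (suc c) |Ω|≡c =
    identityˡ-unique _ _ (≡.trans (≡.sym (ℚΣ.sumBox-⊕ n p _ _)) shifted-total)
    where
    open ≡.≡-Reasoning
    C P : ℕ
    C = suc c ^ suc n
    P = p ^ n
    instance
      C≢0 : NonZero C
      C≢0 = ℕP.m^n≢0 (suc c) (suc n)

    shifted-total : ℚΣ.sumBox n p (λ L → εk Ω (suc n) p L ℚ.+ 1ℚ) ≡ ℚΣ.sumBox n p (λ _ → 1ℚ)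
    shifted-total = begin
      ℚΣ.sumBox n p (λ L → εk Ω (suc n) p L ℚ.+ 1ℚ)
        ≡⟨ ℚΣ.sumBox-cong n p (λ L _ →
             ≡.trans (cong (ℚ._+ 1ℚ) (εk-nonempty Ω (suc n) p L c |Ω|≡c)) (//-rightDividesˡ 1ℚ _)) ⟩
      ℚΣ.sumBox n p (λ L → + (Nk Ω p L * P) / C)
        ≡⟨ sumBox-/ n p _ C ⟩
      + sumBox n p (λ L → Nk Ω p L * P) / C
        ≡⟨ cong (λ s → + s / C) (≡.trans (ℕΣ.sumBox-⊗ʳ n p (Nk Ω p) P)
             (cong (_* P) (≡.trans (sumBox-Nk Ω q n) (cong (_^ suc n) |Ω|≡c)))) ⟩
      + (C * P) / C
        ≡⟨ /-≡ (C * P) C P 1 (≡.trans (ℕP.*-identityʳ (C * P)) (ℕP.*-comm C P)) ⟩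
      + P / 1
        ≡⟨ cong (λ s → + s / 1) (sumBox-1 n p) ⟨
      + sumBox n p (λ _ → 1) / 1
        ≡⟨ sumBox-/ n p (λ _ → 1) 1 ⟨
      ℚΣ.sumBox n p (λ _ → 1ℚ) ∎

∈-primeDivisors⁻ : ∀ {d q} → q ∈ primeDivisors d → Prime q × q ∣ d
∈-primeDivisors⁻ {d} = proj₂ ∘ ∈-filter⁻ (λ p → prime? p ×-dec p ∣? d) {xs = upTo (suc d)}

∈-primeDivisors⁺ : ∀ {d q} .{{_ : NonZero d}} → Prime q → q ∣ d → q ∈ primeDivisors d
∈-primeDivisors⁺ {d} q-prime q∣d =
  ∈-filter⁺ (λ p → prime? p ×-dec p ∣? d) (∈-upTo⁺ (ℕ.s≤s (∣⇒≤ q∣d))) (q-prime , q∣d)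

primeDivisors-unique : ∀ d → Unique (primeDivisors d)
primeDivisors-unique d = filter⁺ (λ p → prime? p ×-dec p ∣? d) (upTo⁺ (suc d))

primeDivisors-nonempty : ∀ {d} → 1 < d → primeDivisors d ≢ []
primeDivisors-nonempty {d} 1<d none = no-factor (factorise d)
  where
  instance
    d≢0 : NonZero d
    d≢0 = ℕ.>-nonZero (ℕP.<-trans (ℕ.s≤s ℕ.z≤n) 1<d)

  no-factor : PrimeFactorisation d → ⊥
  no-factor record { factors = [] ; isFactorisation = d≡1 } = ℕP.<-irrefl (≡.sym d≡1) 1<d
  no-factor record { factors = p ∷ ps ; isFactorisation = d≡p*Πps ; factorsPrime = p-prime ∷ _ } =
    case subst (p ∈_) none (∈-primeDivisors⁺ p-prime (divides (product ps) (≡.trans d≡p*Πps (ℕP.*-comm p _))))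
    of λ ()

squarefree-coprime : ∀ {p m} → Prime p → SquareFree (m * p) → Coprime p m
squarefree-coprime {p} p-prime squarefree (i∣p , i∣m) with prime⇒irreducible p-prime i∣p
... | inj₁ i≡1  = i≡1
... | inj₂ refl = ⊥-elim (squarefree p p-prime (*-monoˡ-∣ p i∣m))

∣-cofactor : ∀ {p q m} → Prime p → Prime q → q ≢ p → q ∣ m * p → q ∣ m
∣-cofactor {m = m} p-prime q-prime q≢p q∣mp with euclidsLemma m _ q-prime q∣mp
... | inj₁ q∣m = q∣m
... | inj₂ q∣p with prime⇒irreducible p-prime q∣p
...   | inj₁ refl = ⊥-elim (¬prime[1] q-prime)
...   | inj₂ q≡p  = ⊥-elim (q≢p q≡p)

record PrimeDivisorSplit (d : ℕ) : Set where
  field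
    p m         : ℕ
    rest        : List ℕ
    divisors    : primeDivisors d ≡ p ∷ rest
    factor      : d ≡ m * p
    coprime     : Coprime p m
    rest-divide : All (_∣ m) rest

primeDivisorSplit : ∀ {d} → 1 < d → SquareFree d → PrimeDivisorSplit d
primeDivisorSplit {d} 1<d squarefree with primeDivisors d in divisors | primeDivisors-unique d
... | []       | _                   = ⊥-elim (primeDivisors-nonempty 1<d divisors)
... | p ∷ rest | p∉rest AllPairs.∷ _ = record
  { p = p ; m = m ; rest = rest ; divisors = divisors ; factor = d≡mp
  ; coprime = squarefree-coprime p-prime (subst SquareFree d≡mp squarefree)
  ; rest-divide = All.tabulate rest-divides-m
  }
  where
  member : ∀ {q} → q ∈ p ∷ rest → Prime q × q ∣ d
  member q∈ = ∈-primeDivisors⁻ (subst (_ ∈_) (≡.sym divisors) q∈)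

  p-prime : Prime p
  p-prime = proj₁ (member (here refl))

  m : ℕ
  m = _∣_.quotient (proj₂ (member (here refl)))

  d≡mp : d ≡ m * p
  d≡mp = _∣_.equality (proj₂ (member (here refl)))

  rest-divides-m : ∀ {q} → q ∈ rest → q ∣ m
  rest-divides-m {q} q∈rest with member (there q∈rest)
  ... | q-prime , q∣d =
    ∣-cofactor p-prime q-prime (≢-sym (All.lookup p∉rest q∈rest)) (subst (q ∣_) d≡mp q∣d)

εProduct : Family → ℕ → List ℕ → List ℕ → ℚ
εProduct Ω k ps L = prodℚ (map (λ p → εk Ω k p L) ps)

εProduct-periodic : ∀ (Ω : Family) k {m} ps → All (_∣ m) ps → ℚΣ.PeriodicBox m (εProduct Ω k ps)
εProduct-periodic Ω k []       []           K≡L = refl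
εProduct-periodic Ω k (p ∷ ps) (p∣m ∷ ps∣m) K≡L =
  cong₂ ℚ._*_ (εk-periodic Ω k p (Pointwise.map (≡-mod-∣ p∣m) K≡L)) (εProduct-periodic Ω k ps ps∣m K≡L)

-- The nonemptiness of the Ω_p is not needed: for empty Ω_p the junk value ε_k = 0 makes every step hold.
lemma3p6 : (Ω : Family) → (∀ p → Prime p → ∃[ t ] Ω p t ≡ true) →
    (k : ℕ) → 2 ≤ k → (d : ℕ) → 1 < d → SquareFree d →
    sumℚ (map (ek Ω k d) (allVecs (k ∸ 1) d)) ≡ 0ℚ
lemma3p6 Ω _ (suc (suc n)) (ℕ.s≤s (ℕ.s≤s ℕ.z≤n)) d 1<d squarefree = begin
  sumℚ (map (ek Ω k d) (allVecs (suc n) d))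
    ≡⟨ ℚΣ.sumList-allVecs (suc n) d (εProduct Ω k (primeDivisors d)) ⟩
  ℚΣ.sumBox (suc n) d (εProduct Ω k (primeDivisors d))
    ≡⟨ cong₂ (λ d ps → ℚΣ.sumBox (suc n) d (εProduct Ω k ps)) factor divisors ⟩
  ℚΣ.sumBox (suc n) (m * p) (λ L → εk Ω k p L ℚ.* εProduct Ω k rest L)
    ≡⟨ ℚΣ.sumBox-periodic-product (coprime-Bézout coprime) (εk-periodic Ω k p)
         (εProduct-periodic Ω k rest rest-divide) (suc n) (sumBox-εk Ω (suc n) p) ⟩
  0ℚ ∎
  where
  k : ℕ
  k = suc (suc n)
  open PrimeDivisorSplit (primeDivisorSplit 1<d squarefree)
  open ≡.≡-Reasoning
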